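{- Let $k,N$ be positive integers and let $d,d'$ be integers with $d,d'\in\left(\frac N3-\frac{N}{48k+15},\ \frac N3+\frac{N}{48k+15}\right)$ and $d'<d$. Suppose that $\beta d+i=\beta' d'+i'$, where $\beta,\beta'\in[0,4k-1]$, $i\in[1,d]$ and $i'\in[1,d']$ are integers. Then either $\beta'=\beta$ or $\beta'=\beta+1$.
   Context: $[a,b]$ denotes the set of integers $\{a,a+1,\dots,b\}$. -}

module Defs where

open import Data.Integer using (ℤ; +_; _+_; _*_; _-_; _<_; _≤_)
open import Data.Product using (_×_)

-- d lies in the open interval (N/3 - N/(48k+15), N/3 + N/(48k+15)),
-- cleared of denominators: with M = 48k+15 > 0 and multiplying by 3M,
-- N*M - 3*N < 3*d*M < N*M + 3*N.
InWindow : ℤ → ℤ → ℤ → Set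
InWindow k N d =
  let M = + 48 * k + + 15 in
  (N * M - + 3 * N < + 3 * d * M) × (+ 3 * d * M < N * M + + 3 * N)

-- The numbers βd + i with i ∈ [1, d] fill the block (βd, (β+1)d]. Since d′ < d, a block
-- β′ < β of d′ ends before block β of d begins, which rules out β′ < β. The window has
-- width 2N/(48k+15), so even for β < 4k the drift (β+1)(d − d′) stays below d′ ≈ N/3;
-- hence (β+1)d < (β+2)d′, which rules out β′ ≥ β + 2.
module Submission where

open import Defs
open import Data.Integer using (ℤ; +_; _+_; _*_; _-_; _<_; _≤_; 0ℤ; +≤+; nonNegative)
open import Data.Integer.Properties
open import Data.Integer.Tactic.RingSolver using (solve)
open import Data.List using (_∷_; [])
open import Data.Nat using (z≤n)
open import Data.Product using (_,_)
open import Data.Sum using (_⊎_; inj₁; inj₂)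
open import Relation.Binary.PropositionalEquality using (_≡_; sym; subst)
open import Relation.Nullary using (¬_; yes; no)

private
  variable
    k N d d′ β i j : ℤ

0≤+ : ∀ n → 0ℤ ≤ + n
0≤+ n = +≤+ z≤n

0≤i⇒0≤n*i : ∀ n → 0ℤ ≤ i → 0ℤ ≤ + n * i
0≤i⇒0≤n*i {i} n 0≤i = subst (_≤ + n * i) (*-zeroʳ (+ n)) (*-monoˡ-≤-nonNeg (+ n) 0≤i)

0≤j⇒i≤i+j : 0ℤ ≤ j → i ≤ i + j
0≤j⇒i≤i+j {j} {i} 0≤j = subst (_≤ i + j) (+-identityʳ i) (+-monoʳ-≤ i 0≤j)

1≤j⇒i<i+j : + 1 ≤ j → i < i + j
1≤j⇒i<i+j {j} {i} 1≤j = subst (i <_) (+-comm j i) (suc[i]≤j⇒i<j (+-monoˡ-≤ i 1≤j))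

i<j⇒i+1≤j : i < j → i + + 1 ≤ j
i<j⇒i+1≤j {i} i<j = subst (_≤ _) (+-comm (+ 1) i) (i<j⇒suc[i]≤j i<j)

i≤j-1⇒i+1≤j : i ≤ j - + 1 → i + + 1 ≤ j
i≤j-1⇒i+1≤j {i} {j} i≤j-1 = begin
  i + + 1          ≤⟨ +-monoˡ-≤ (+ 1) i≤j-1 ⟩
  j - + 1 + + 1    ≡⟨ solve (j ∷ []) ⟩
  j                ∎
  where open ≤-Reasoning

i≤j≤i+1⇒j≡i∨j≡i+1 : i ≤ j → j ≤ i + + 1 → j ≡ i ⊎ j ≡ i + + 1
i≤j≤i+1⇒j≡i∨j≡i+1 {i} {j} i≤j j≤i+1 with i ≟ j
... | yes i≡j = inj₁ (sym i≡j)
... | no  i≢j = inj₂ (≤-antisym j≤i+1 (i<j⇒i+1≤j (≤∧≢⇒< i≤j i≢j)))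

block-< : ∀ {i i′} β d β′ d′ → i ≤ d → + 1 ≤ i′ → (β + + 1) * d ≤ β′ * d′ →
          β * d + i < β′ * d′ + i′
block-< {i} {i′} β d β′ d′ i≤d 1≤i′ block-order = begin-strict
  β * d + i      ≤⟨ +-monoʳ-≤ (β * d) i≤d ⟩
  β * d + d      ≡⟨ solve (β ∷ d ∷ []) ⟩
  (β + + 1) * d  ≤⟨ block-order ⟩
  β′ * d′        <⟨ 1≤j⇒i<i+j 1≤i′ ⟩
  β′ * d′ + i′   ∎
  where open ≤-Reasoning

InWindow-width : InWindow k N d → InWindow k N d′ →
                 + 3 * d * (+ 48 * k + + 15) < + 3 * d′ * (+ 48 * k + + 15) + + 6 * N
InWindow-width {k} {N} {d} {d′} (_ , upper) (lower′ , _) = begin-strict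
  + 3 * d * (+ 48 * k + + 15)                <⟨ upper ⟩
  N * (+ 48 * k + + 15) + + 3 * N            ≡⟨ solve (N ∷ k ∷ []) ⟩
  N * (+ 48 * k + + 15) - + 3 * N + + 6 * N  <⟨ +-monoˡ-< (+ 6 * N) lower′ ⟩
  + 3 * d′ * (+ 48 * k + + 15) + + 6 * N     ∎
  where open ≤-Reasoning

InWindow-lower : 0ℤ ≤ k → 0ℤ ≤ N → InWindow k N d → + 24 * k * N < + 3 * d * (+ 48 * k + + 15)
InWindow-lower {k} {N} {d} 0≤k 0≤N (lower , _) = begin-strict
  + 24 * k * N                          ≤⟨ 0≤j⇒i≤i+j 0≤slack ⟩
  + 24 * k * N + (+ 24 * k + + 12) * N  ≡⟨ solve (k ∷ N ∷ []) ⟩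
  N * (+ 48 * k + + 15) - + 3 * N       <⟨ lower ⟩
  + 3 * d * (+ 48 * k + + 15)           ∎
  where
  open ≤-Reasoning
  0≤slack : 0ℤ ≤ (+ 24 * k + + 12) * N
  0≤slack = *-monoʳ-≤-nonNeg N {{nonNegative 0≤N}} (+-mono-≤ (0≤i⇒0≤n*i 24 0≤k) (0≤+ 12))

0≤3*[48k+15] : 0ℤ ≤ k → 0ℤ ≤ + 3 * (+ 48 * k + + 15)
0≤3*[48k+15] 0≤k = 0≤i⇒0≤n*i 3 (+-mono-≤ (0≤i⇒0≤n*i 48 0≤k) (0≤+ 15))

InWindow⇒0< : 0ℤ ≤ k → 0ℤ ≤ N → InWindow k N d → 0ℤ < d
InWindow⇒0< {k} {N} {d} 0≤k 0≤N window =
  *-cancelˡ-<-nonNeg (+ 3 * (+ 48 * k + + 15)) {{nonNegative (0≤3*[48k+15] 0≤k)}} (begin-strict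
    + 3 * (+ 48 * k + + 15) * 0ℤ  ≡⟨ *-zeroʳ (+ 3 * (+ 48 * k + + 15)) ⟩
    0ℤ                            ≤⟨ *-monoʳ-≤-nonNeg N {{nonNegative 0≤N}} (0≤i⇒0≤n*i 24 0≤k) ⟩
    + 24 * k * N                  <⟨ InWindow-lower {d = d} 0≤k 0≤N window ⟩
    + 3 * d * (+ 48 * k + + 15)   ≡⟨ solve (d ∷ k ∷ []) ⟩
    + 3 * (+ 48 * k + + 15) * d   ∎)
  where open ≤-Reasoning

InWindow⇒[β+1]d<[β+2]d′ : 0ℤ ≤ k → 0ℤ ≤ N → 0ℤ ≤ β → β + + 1 ≤ + 4 * k →
                          InWindow k N d → InWindow k N d′ → (β + + 1) * d < (β + + 2) * d′
InWindow⇒[β+1]d<[β+2]d′ {k} {N} {β} {d} {d′} 0≤k 0≤N 0≤β β+1≤4k window window′ =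
  *-cancelˡ-<-nonNeg (+ 3 * (+ 48 * k + + 15)) {{nonNegative (0≤3*[48k+15] 0≤k)}} (begin-strict
    + 3 * (+ 48 * k + + 15) * ((β + + 1) * d)
      ≡⟨ solve (k ∷ β ∷ d ∷ []) ⟩
    (β + + 1) * (+ 3 * d * (+ 48 * k + + 15))
      ≤⟨ *-monoˡ-≤-nonNeg (β + + 1) {{nonNegative 0≤β+1}} (<⇒≤ width) ⟩
    (β + + 1) * (+ 3 * d′ * (+ 48 * k + + 15) + + 6 * N)
      ≡⟨ *-distribˡ-+ (β + + 1) _ _ ⟩
    (β + + 1) * (+ 3 * d′ * (+ 48 * k + + 15)) + (β + + 1) * (+ 6 * N)
      ≤⟨ +-monoʳ-≤ ((β + + 1) * (+ 3 * d′ * (+ 48 * k + + 15))) drift≤ ⟩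
    (β + + 1) * (+ 3 * d′ * (+ 48 * k + + 15)) + + 4 * k * (+ 6 * N)
      ≡⟨ solve (k ∷ β ∷ d′ ∷ N ∷ []) ⟩
    (β + + 1) * (+ 3 * d′ * (+ 48 * k + + 15)) + + 24 * k * N
      <⟨ +-monoʳ-< ((β + + 1) * (+ 3 * d′ * (+ 48 * k + + 15))) (InWindow-lower {d = d′} 0≤k 0≤N window′) ⟩
    (β + + 1) * (+ 3 * d′ * (+ 48 * k + + 15)) + + 3 * d′ * (+ 48 * k + + 15)
      ≡⟨ solve (k ∷ β ∷ d′ ∷ []) ⟩
    + 3 * (+ 48 * k + + 15) * ((β + + 2) * d′) ∎)
  where
  open ≤-Reasoning
  0≤β+1 : 0ℤ ≤ β + + 1
  0≤β+1 = +-mono-≤ 0≤β (0≤+ 1)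
  width : + 3 * d * (+ 48 * k + + 15) < + 3 * d′ * (+ 48 * k + + 15) + + 6 * N
  width = InWindow-width {k = k} {N = N} {d = d} {d′ = d′} window window′
  drift≤ : (β + + 1) * (+ 6 * N) ≤ + 4 * k * (+ 6 * N)
  drift≤ = *-monoʳ-≤-nonNeg (+ 6 * N) {{nonNegative (0≤i⇒0≤n*i 6 0≤N)}} β+1≤4k

lemma16 : (k N d d′ β β′ i i′ : ℤ) →
    + 1 ≤ k → + 1 ≤ N →
    InWindow k N d → InWindow k N d′ → d′ < d →
    + 0 ≤ β → β ≤ + 4 * k - + 1 →
    + 0 ≤ β′ → β′ ≤ + 4 * k - + 1 →
    + 1 ≤ i → i ≤ d → + 1 ≤ i′ → i′ ≤ d′ →
    β * d + i ≡ β′ * d′ + i′ →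
    (β′ ≡ β) ⊎ (β′ ≡ β + + 1)
lemma16 k N d d′ β β′ i i′ 1≤k 1≤N window window′ d′<d 0≤β β≤4k-1 _ _ 1≤i i≤d 1≤i′ i′≤d′ eq =
  i≤j≤i+1⇒j≡i∨j≡i+1 (≮⇒≥ not-below) (≮⇒≥ not-above)
  where
  0≤k : 0ℤ ≤ k
  0≤k = ≤-trans (0≤+ 1) 1≤k
  0≤N : 0ℤ ≤ N
  0≤N = ≤-trans (0≤+ 1) 1≤N
  0≤d′ : 0ℤ ≤ d′
  0≤d′ = <⇒≤ (InWindow⇒0< {d = d′} 0≤k 0≤N window′)
  open ≤-Reasoning

  not-below : ¬ β′ < β
  not-below β′<β = <-irrefl (sym eq) (block-< β′ d′ β d i′≤d′ 1≤i (begin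
    (β′ + + 1) * d′  ≤⟨ *-monoʳ-≤-nonNeg d′ {{nonNegative 0≤d′}} (i<j⇒i+1≤j β′<β) ⟩
    β * d′           ≤⟨ *-monoˡ-≤-nonNeg β {{nonNegative 0≤β}} (<⇒≤ d′<d) ⟩
    β * d            ∎))

  not-above : ¬ β + + 1 < β′
  not-above β+1<β′ = <-irrefl eq (block-< β d β′ d′ i≤d 1≤i′ (begin
    (β + + 1) * d   ≤⟨ <⇒≤ (InWindow⇒[β+1]d<[β+2]d′ 0≤k 0≤N 0≤β (i≤j-1⇒i+1≤j β≤4k-1) window window′) ⟩
    (β + + 2) * d′  ≤⟨ *-monoʳ-≤-nonNeg d′ {{nonNegative 0≤d′}} β+2≤β′ ⟩
    β′ * d′         ∎))
    where
    β+2≤β′ : β + + 2 ≤ β′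
    β+2≤β′ = subst (_≤ β′) (+-assoc β (+ 1) (+ 1)) (i<j⇒i+1≤j β+1<β′)
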